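{- Let $L$ be a porous subset of $\mathbb{N}$. Then there is an infinite set $S \subseteq \mathbb{N}$ such that for every nonempty finite subset $S' \subseteq S$, the sum of the elements of $S'$ is not in $L$.
   Context: $\mathbb{N}$ denotes the set of positive integers. A set $L \subseteq \mathbb{N}$ is porous if for every $n \in \mathbb{N}$, the set $\mathbb{N}\setminus L$ contains $n$ consecutive integers. -}

module Defs where

open import Data.Nat using (ℕ; _≤_; _<_)
open import Data.Nat.Base using (_+_)
open import Data.Product using (_×_; ∃-syntax)
open import Data.List using (List; [])
open import Data.List.Relation.Unary.All using (All)
open import Data.List.Relation.Unary.Unique.Propositional using (Unique)
open import Relation.Nullary using (¬_)
open import Relation.Binary.PropositionalEquality using (_≢_)

-- Subsets of ℕ as predicates. The paper's ℕ is the positive integers;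
-- positivity is imposed explicitly where needed.
Subset : Set₁
Subset = ℕ → Set

PositiveSubset : Subset → Set
PositiveSubset A = ∀ m → A m → 1 ≤ m

Porous : Subset → Set
Porous L = ∀ (n : ℕ) → ∃[ a ] (1 ≤ a × (∀ i → i < n → ¬ L (a + i)))

Infinite : Subset → Set
Infinite S = ∀ (n : ℕ) → ∃[ m ] (n < m × S m)

NonemptyFiniteSubsetOf : Subset → List ℕ → Set
NonemptyFiniteSubsetOf S xs = Unique xs × All S xs × xs ≢ []

{-# OPTIONS --safe #-}
-- Choose s₀, s₁, … greedily. With Pₖ = s₀ + ⋯ + sₖ₋₁, take a gap
-- [a, a + 2(Pₖ + 1)) of the complement of L and put sₖ = a + Pₖ + 1, so
-- that sₖ + t ∉ L for every t ≤ Pₖ. A nonempty finite set of terms whose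
-- largest index is k sums to sₖ + t, where t is a sum of distinct earlier
-- terms and hence t ≤ Pₖ.
module Submission where

open import Defs
open import Data.Nat using (ℕ; zero; suc; _+_; _≤_; _<_; _⊔_; z≤n; s≤s)
open import Data.Nat.Properties
  using ( ≤-trans; ≤-reflexive; <-≤-trans; +-monoʳ-<; +-monoʳ-≤; +-assoc
        ; m≤n+m; m≤m+n; m≤m⊔n; m≤n⊔m)
open import Data.Nat.ListAction using (sum)
open import Data.Nat.ListAction.Properties using (sum-↭)
open import Data.Product using (_×_; _,_; proj₁; proj₂; Σ-syntax; ∃-syntax)
open import Data.Sum using (inj₁; inj₂)
open import Data.List using (List; []; _∷_; _++_; applyDownFrom)
open import Data.List.Relation.Unary.All using (All; []; _∷_)
open import Data.List.Relation.Unary.AllPairs using (_∷_)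
open import Data.List.Relation.Unary.Unique.Propositional using (Unique)
open import Data.List.Relation.Unary.Unique.Propositional.Properties
  using (Unique[x∷xs]⇒x∉xs)
open import Data.List.Membership.Propositional using (_∈_)
open import Data.List.Membership.Propositional.Properties
  using (∈-∃++; ∈-applyDownFrom⁺; ∈-applyDownFrom⁻)
open import Data.List.Relation.Binary.Subset.Propositional using (_⊆_)
open import Data.List.Relation.Binary.Subset.Propositional.Properties
  using (⊆-trans; ⊆-reflexive-↭; ⊆[]⇒≡[]; xs⊆x∷xs; ∈-∷⁺ʳ; ⊆∷⇒∈∨⊆; ⊆∷∧∉⇒⊆)
open import Data.List.Relation.Binary.Permutation.Propositional using (_↭_; ↭-sym; ↭⇒↭ₛ)
open import Data.List.Relation.Binary.Permutation.Propositional.Properties using (shift)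
open import Data.List.Relation.Binary.Permutation.Setoid.Properties using (Unique-resp-↭)
open import Relation.Binary.PropositionalEquality using (_≡_; _≢_; refl; sym; subst; setoid)
open import Relation.Nullary using (¬_)

private
  variable
    A : Set
    v : A
    xs ys : List A

∈-Unique⇒↭∷ : Unique xs → v ∈ xs → ∃[ zs ] (xs ↭ v ∷ zs × Unique (v ∷ zs))
∈-Unique⇒↭∷ {v = v} u v∈xs with ys , zs , refl ← ∈-∃++ v∈xs =
  ys ++ zs , shift v ys zs , Unique-resp-↭ (setoid _) (↭⇒↭ₛ (shift v ys zs)) u

⊆∷-split : Unique xs → xs ⊆ v ∷ ys → v ∈ xs →
           ∃[ zs ] (xs ↭ v ∷ zs × Unique zs × zs ⊆ ys)
⊆∷-split u xs⊆v∷ys v∈xs with zs , xs↭v∷zs , u′@(_ ∷ zs-unique) ← ∈-Unique⇒↭∷ u v∈xs =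
  zs , xs↭v∷zs , zs-unique ,
  ⊆∷∧∉⇒⊆ (⊆-trans (⊆-trans (xs⊆x∷xs zs _) (⊆-reflexive-↭ (↭-sym xs↭v∷zs))) xs⊆v∷ys)
         (Unique[x∷xs]⇒x∉xs u′)

sum-mono-⊆ : ∀ {xs ys} → Unique xs → xs ⊆ ys → sum xs ≤ sum ys
sum-mono-⊆ {xs} {[]} _ xs⊆[] rewrite ⊆[]⇒≡[] xs⊆[] = z≤n
sum-mono-⊆ {xs} {y ∷ ys} u xs⊆y∷ys with ⊆∷⇒∈∨⊆ xs⊆y∷ys
... | inj₂ xs⊆ys = ≤-trans (sum-mono-⊆ u xs⊆ys) (m≤n+m (sum ys) y)
... | inj₁ y∈xs with zs , xs↭y∷zs , u′ , zs⊆ys ← ⊆∷-split u xs⊆y∷ys y∈xs =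
  subst (_≤ y + sum ys) (sym (sum-↭ xs↭y∷zs)) (+-monoʳ-≤ y (sum-mono-⊆ u′ zs⊆ys))

applyDownFrom⁺ : ∀ (f : ℕ → A) {m n} → m ≤ n → applyDownFrom f m ⊆ applyDownFrom f n
applyDownFrom⁺ f m≤n x∈ with i , i<m , refl ← ∈-applyDownFrom⁻ f x∈ =
  ∈-applyDownFrom⁺ f (<-≤-trans i<m m≤n)

image⊆applyDownFrom : ∀ (f : ℕ → A) {xs} → All (λ x → ∃[ i ] f i ≡ x) xs →
                      ∃[ n ] xs ⊆ applyDownFrom f n
image⊆applyDownFrom f [] = 0 , λ ()
image⊆applyDownFrom f ((i , refl) ∷ ps) with n , xs⊆ ← image⊆applyDownFrom f ps =
  suc i ⊔ n ,
  ∈-∷⁺ʳ (∈-applyDownFrom⁺ f (m≤m⊔n (suc i) n))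
        (⊆-trans xs⊆ (applyDownFrom⁺ f (m≤n⊔m (suc i) n)))

gap-above : ∀ {L} → Porous L → ∀ p → ∃[ s ] (p < s × ∀ t → t ≤ p → ¬ L (s + t))
gap-above {L} por p with a , _ , a+i∉L ← por (suc p + suc p) =
  a + suc p , m≤n+m (suc p) a ,
  λ t t≤p → subst (λ m → ¬ L m) (sym (+-assoc a (suc p) t))
                   (a+i∉L (suc p + t) (+-monoʳ-< (suc p) (s≤s t≤p)))

module Construction (L : Subset) (por : Porous L) where

  next : ℕ → ℕ
  next p = proj₁ (gap-above {L} por p)

  partialSum : ℕ → ℕ
  partialSum zero    = 0
  partialSum (suc k) = next (partialSum k) + partialSum k

  s : ℕ → ℕ
  s k = next (partialSum k)

  S : Subset
  S m = ∃[ k ] s k ≡ m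

  partialSum<s : ∀ k → partialSum k < s k
  partialSum<s k = proj₁ (proj₂ (gap-above {L} por (partialSum k)))

  s+t∉L : ∀ k t → t ≤ partialSum k → ¬ L (s k + t)
  s+t∉L k = proj₂ (proj₂ (gap-above {L} por (partialSum k)))

  sum-applyDownFrom : ∀ k → sum (applyDownFrom s k) ≡ partialSum k
  sum-applyDownFrom zero    = refl
  sum-applyDownFrom (suc k) rewrite sum-applyDownFrom k = refl

  n≤partialSum : ∀ n → n ≤ partialSum n
  n≤partialSum zero    = z≤n
  n≤partialSum (suc n) =
    <-≤-trans (<-≤-trans (s≤s (n≤partialSum n)) (partialSum<s n)) (m≤m+n (s n) (partialSum n))

  S-positive : PositiveSubset S
  S-positive _ (k , refl) = <-≤-trans (s≤s z≤n) (partialSum<s k)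

  S-infinite : Infinite S
  S-infinite n = s n , <-≤-trans (s≤s (n≤partialSum n)) (partialSum<s n) , n , refl

  sum∉L : ∀ k {xs} → Unique xs → xs ⊆ applyDownFrom s k → xs ≢ [] → ¬ L (sum xs)
  sum∉L zero    _ xs⊆[] xs≢[] _ = xs≢[] (⊆[]⇒≡[] xs⊆[])
  sum∉L (suc k) u xs⊆ xs≢[] with ⊆∷⇒∈∨⊆ xs⊆
  ... | inj₂ xs⊆′ = sum∉L k u xs⊆′ xs≢[]
  ... | inj₁ sk∈xs with zs , xs↭sk∷zs , u′ , zs⊆ ← ⊆∷-split u xs⊆ sk∈xs =
    subst (λ m → ¬ L m) (sym (sum-↭ xs↭sk∷zs))
      (s+t∉L k (sum zs) (≤-trans (sum-mono-⊆ u′ zs⊆) (≤-reflexive (sum-applyDownFrom k))))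

lemma3p1 : (L : Subset) → PositiveSubset L → Porous L →
    Σ[ S ∈ Subset ] (PositiveSubset S × Infinite S ×
      (∀ (xs : List ℕ) → NonemptyFiniteSubsetOf S xs → ¬ L (sum xs)))
lemma3p1 L _ por = S , S-positive , S-infinite , sum-of-finite-subset∉L
  where
  open Construction L por
  sum-of-finite-subset∉L : ∀ xs → NonemptyFiniteSubsetOf S xs → ¬ L (sum xs)
  sum-of-finite-subset∉L xs (u , xs⊆S , xs≢[]) with k , xs⊆ ← image⊆applyDownFrom s xs⊆S =
    sum∉L k u xs⊆ xs≢[]
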